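{- Let $G=(V_1,V_2,V_3;E)$ be a balanced tripartite graph on $3M$ vertices such that each vertex is adjacent to at least $(3/4)M$ vertices in each of the other two vertex classes. Then $G$ contains $M$ vertex-disjoint triangles. -}

module Defs where

open import Data.Nat using (ℕ; _*_; _≤_)
open import Data.Bool using (Bool; true; false; T)
open import Data.Fin using (Fin)
open import Data.List using (List; length; filter)
open import Data.List using (allFin)
open import Data.Product using (_×_; Σ; _,_; proj₁; proj₂)
open import Relation.Binary.PropositionalEquality using (_≡_)
open import Relation.Nullary using (¬_)
open import Data.Bool using (T?)

-- Edges only go between different classes; e₁₂ i j says vertex i of V₁ is
-- adjacent to vertex j of V₂, etc.  (Adjacency is symmetric, so one Boolean
-- relation per pair of classes describes the graph.)
record Tripartite (M : ℕ) : Set where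
  field
    e₁₂ : Fin M → Fin M → Bool
    e₁₃ : Fin M → Fin M → Bool
    e₂₃ : Fin M → Fin M → Bool
open Tripartite public

countT : {M : ℕ} → (Fin M → Bool) → ℕ
countT {M} p = length (filter (λ j → T? (p j)) (allFin M))

MinDegree : {M : ℕ} → Tripartite M → Set
MinDegree {M} G =
  (∀ i → 3 * M ≤ 4 * countT (λ j → e₁₂ G i j)) ×
  (∀ i → 3 * M ≤ 4 * countT (λ k → e₁₃ G i k)) ×
  (∀ j → 3 * M ≤ 4 * countT (λ i → e₁₂ G i j)) ×
  (∀ j → 3 * M ≤ 4 * countT (λ k → e₂₃ G j k)) ×
  (∀ k → 3 * M ≤ 4 * countT (λ i → e₁₃ G i k)) ×
  (∀ k → 3 * M ≤ 4 * countT (λ j → e₂₃ G j k))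

-- a triangle in a tripartite graph has exactly one vertex in each class
Triple : ℕ → Set
Triple M = Fin M × Fin M × Fin M

IsTriangle : {M : ℕ} → Tripartite M → Triple M → Set
IsTriangle G (a , b , c) = T (e₁₂ G a b) × T (e₁₃ G a c) × T (e₂₃ G b c)

-- two triangles are vertex-disjoint (vertices in different classes are distinct)
Disjoint : {M : ℕ} → Triple M → Triple M → Set
Disjoint (a , b , c) (a' , b' , c') = ¬ a ≡ a' × ¬ b ≡ b' × ¬ c ≡ c'

HasDisjointTriangles : {M : ℕ} → Tripartite M → ℕ → Set
HasDisjointTriangles {M} G n =
  Σ (Fin n → Triple M) λ t →
    (∀ r → IsTriangle G (t r)) × (∀ r s → ¬ r ≡ s → Disjoint (t r) (t s))

module Submission where

-- A triangle family covering all 3M vertices is the same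
-- as a pair of permutations σ, τ of Fin M such that every r ∈ V₁ is adjacent
-- to σ r ∈ V₂ and to τ r ∈ V₃, and σ r is adjacent to τ r.  Both
-- permutations come from one matching lemma:
--
--   (Dirac-type matching) a bipartite graph between two copies of Fin M in
--   which every vertex has degree ≥ M/2 has a perfect matching.
--
-- It is proved by repairing a permutation: if r is not matched to σ r, the
-- sets {x | r ~ σ x} and {x | x ~ σ r} have size ≥ M/2 and both miss r, so
-- they meet in some x; swapping the partners of r and x matches r without
-- unmatching anybody.  First σ matches V₁ with V₂.  Then τ is a perfect
-- matching of the auxiliary bipartite graph on V₁ × V₃ joining a to c when c
-- is a common neighbour of a and σ a; it again has degrees ≥ M/2 because two subsets of Fin M of size ≥ 3M/4
-- intersect in ≥ M/2 elements (inclusion–exclusion).  The triangles are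
-- then r, σ r, τ r, disjoint because σ and τ are injective.

open import Defs
open import Data.Nat using (ℕ; zero; suc; _+_; _*_; _≤_; _<_; z≤n; s≤s)
open import Data.Nat.Properties hiding (_≟_)
open import Data.Bool using (Bool; true; false; T; _∧_; _∨_; T?)
open import Data.Bool.Properties using (T-∧; T-∨)
open import Data.Fin using (Fin; zero; suc)
open import Data.Fin.Properties using (_≟_; all?; ¬∀⟶∃¬)
open import Data.Fin.Permutation using (Permutation; _⟨$⟩ʳ_; _∘ₚ_; transpose)
import Data.Fin.Permutation as Perm
import Data.Fin.Permutation.Components as PC
open import Data.List using (length; filter; tabulate)
open import Data.Product using (_×_; Σ; _,_; proj₁; proj₂; ∃; map₂)
open import Data.Sum using (_⊎_; inj₁; inj₂; [_,_]′)
open import Data.Empty using (⊥-elim)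
open import Data.Unit using (tt)
open import Function using (_∘_; Equivalence; Injection)
open import Function.Properties.Inverse using (↔⇒↣)
open import Relation.Binary.PropositionalEquality
open import Relation.Nullary using (¬_; yes; no)
open import Algebra.Properties.CommutativeSemigroup +-commutativeSemigroup using (interchange)
import Algebra.Properties.CommutativeMonoid.Sum as Summation

open Summation +-0-commutativeMonoid using (sum; sum-permute)

indicator : Bool → ℕ
indicator true  = 1
indicator false = 0

count : {M : ℕ} → (Fin M → Bool) → ℕ
count p = sum (indicator ∘ p)

length-filter-tabulate : {A : Set} {M : ℕ} (P : A → Bool) (g : Fin M → A) →
  length (filter (λ a → T? (P a)) (tabulate g)) ≡ count (P ∘ g)
length-filter-tabulate {M = zero}  P g = refl
length-filter-tabulate {M = suc M} P g with P (g zero)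
... | true  = cong suc (length-filter-tabulate P (g ∘ suc))
... | false = length-filter-tabulate P (g ∘ suc)

countT≡count : {M : ℕ} (p : Fin M → Bool) → countT p ≡ count p
countT≡count p = length-filter-tabulate p (λ i → i)

count-permute : {M : ℕ} (p : Fin M → Bool) (π : Permutation M M) →
  count (λ i → p (π ⟨$⟩ʳ i)) ≡ count p
count-permute p π = sym (sum-permute (indicator ∘ p) π)

count-∧-∨ : {M : ℕ} (p q : Fin M → Bool) →
  count p + count q ≡ count (λ i → p i ∧ q i) + count (λ i → p i ∨ q i)
count-∧-∨ {zero}  p q = refl
count-∧-∨ {suc M} p q = begin
  (indicator (p zero) + count (p ∘ suc)) + (indicator (q zero) + count (q ∘ suc))
    ≡⟨ interchange (indicator (p zero)) _ _ _ ⟩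
  (indicator (p zero) + indicator (q zero)) + (count (p ∘ suc) + count (q ∘ suc))
    ≡⟨ cong₂ _+_ (pointwise (p zero) (q zero)) (count-∧-∨ (p ∘ suc) (q ∘ suc)) ⟩
  (indicator (p zero ∧ q zero) + indicator (p zero ∨ q zero))
    + (count (λ i → p (suc i) ∧ q (suc i)) + count (λ i → p (suc i) ∨ q (suc i)))
    ≡⟨ interchange (indicator (p zero ∧ q zero)) _ _ _ ⟩
  count (λ i → p i ∧ q i) + count (λ i → p i ∨ q i) ∎
  where
  open ≡-Reasoning
  pointwise : ∀ a b → indicator a + indicator b ≡ indicator (a ∧ b) + indicator (a ∨ b)
  pointwise true  true  = refl
  pointwise true  false = refl
  pointwise false true  = refl
  pointwise false false = refl

indicator-mono : ∀ a b → (T a → T b) → indicator a ≤ indicator b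
indicator-mono false b     _   = z≤n
indicator-mono true  true  _   = ≤-refl
indicator-mono true  false a⇒b = ⊥-elim (a⇒b tt)

count-mono : {M : ℕ} (p q : Fin M → Bool) → (∀ i → T (p i) → T (q i)) → count p ≤ count q
count-mono {zero}  p q p⊆q = z≤n
count-mono {suc M} p q p⊆q =
  +-mono-≤ (indicator-mono (p zero) (q zero) (p⊆q zero)) (count-mono (p ∘ suc) (q ∘ suc) (p⊆q ∘ suc))

count-strict : {M : ℕ} (p q : Fin M → Bool) → (∀ i → T (p i) → T (q i)) →
  (u : Fin M) → T (q u) → ¬ T (p u) → count p < count q
count-strict {suc M} p q p⊆q zero qu ¬pu with p zero | q zero
... | true  | _     = ⊥-elim (¬pu tt)
... | false | true  = s≤s (count-mono (p ∘ suc) (q ∘ suc) (p⊆q ∘ suc))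
... | false | false = ⊥-elim qu
count-strict {suc M} p q p⊆q (suc u) qu ¬pu =
  +-mono-≤-< (indicator-mono (p zero) (q zero) (p⊆q zero))
             (count-strict (p ∘ suc) (q ∘ suc) (p⊆q ∘ suc) u qu ¬pu)

count-full : (M : ℕ) → count {M} (λ _ → true) ≡ M
count-full zero    = refl
count-full (suc M) = cong suc (count-full M)

count≤size : {M : ℕ} (p : Fin M → Bool) → count p ≤ M
count≤size {M} p = subst (count p ≤_) (count-full M) (count-mono p (λ _ → true) (λ _ _ → tt))

count<size : {M : ℕ} (p : Fin M → Bool) (u : Fin M) → ¬ T (p u) → count p < M
count<size {M} p u ¬pu =
  subst (count p <_) (count-full M) (count-strict p (λ _ → true) (λ _ _ → tt) u tt ¬pu)

count-witness : {M : ℕ} (p : Fin M → Bool) → 0 < count p → ∃ λ i → T (p i)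
count-witness {suc M} p positive with p zero in eq
... | true  = zero , subst T (sym eq) tt
... | false with count-witness (p ∘ suc) positive
...   | i , t = suc i , t

halve : (M a : ℕ) → 2 * M ≤ 4 * a → M ≤ 2 * a
halve M a h = *-cancelˡ-≤ 2 (subst (2 * M ≤_) (*-assoc 2 2 a) h)

three-quarters⇒half : (M a : ℕ) → 3 * M ≤ 4 * a → M ≤ 2 * a
three-quarters⇒half M a h = halve M a (≤-trans (*-monoˡ-≤ M (n≤1+n 2)) h)

halves-fill : (M a b : ℕ) → M ≤ 2 * a → M ≤ 2 * b → M ≤ a + b
halves-fill M a b ha hb =
  *-cancelˡ-≤ 2 (subst (2 * M ≤_) (sym (*-distribˡ-+ 2 a b))
    (subst (λ z → M + z ≤ 2 * a + 2 * b) (sym (+-identityʳ M)) (+-mono-≤ ha hb)))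

-- the arithmetic core of "two 3/4-dense sets overlap in a 1/2-dense set":
-- if a + b ≤ c + M with a, b ≥ 3M/4, then c ≥ M/2
three-quarters-overlap : (M a b c : ℕ) →
  3 * M ≤ 4 * a → 3 * M ≤ 4 * b → a + b ≤ c + M → M ≤ 2 * c
three-quarters-overlap M a b c ha hb h =
  halve M c (+-cancelʳ-≤ (4 * M) (2 * M) (4 * c) six-M)
  where
  open ≤-Reasoning
  six-M : 2 * M + 4 * M ≤ 4 * c + 4 * M
  six-M = begin
    2 * M + 4 * M  ≡⟨ trans (sym (*-distribʳ-+ M 2 4)) (*-distribʳ-+ M 3 3) ⟩
    3 * M + 3 * M  ≤⟨ +-mono-≤ ha hb ⟩
    4 * a + 4 * b  ≡⟨ *-distribˡ-+ 4 a b ⟨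
    4 * (a + b)    ≤⟨ *-monoʳ-≤ 4 h ⟩
    4 * (c + M)    ≡⟨ *-distribˡ-+ 4 c M ⟩
    4 * c + 4 * M  ∎

halves-intersect : {M : ℕ} (p q : Fin M → Bool) → M ≤ 2 * count p → M ≤ 2 * count q →
  (u : Fin M) → ¬ T (p u) → ¬ T (q u) → ∃ λ x → T (p x) × T (q x)
halves-intersect {M} p q hp hq u ¬pu ¬qu
  with count (λ x → p x ∧ q x) | count-∧-∨ p q | count-witness (λ x → p x ∧ q x)
... | suc _ | _ | witness = map₂ (Equivalence.to T-∧) (witness (s≤s z≤n))
... | zero  | inclusion-exclusion | _ =
  ⊥-elim (<⇒≱ union-small (halves-fill M (count p) (count q) hp hq))
  where
  union-small : count p + count q < M
  union-small = subst (_< M) (sym inclusion-exclusion)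
    (count<size (λ x → p x ∨ q x) u ([ ¬pu , ¬qu ]′ ∘ Equivalence.to T-∨))

three-quarters-meet : {M : ℕ} (p q : Fin M → Bool) →
  3 * M ≤ 4 * count p → 3 * M ≤ 4 * count q → M ≤ 2 * count (λ x → p x ∧ q x)
three-quarters-meet {M} p q hp hq =
  three-quarters-overlap M (count p) (count q) (count p∧q) hp hq
    (subst (_≤ count p∧q + M) (sym (count-∧-∨ p q)) (+-monoʳ-≤ (count p∧q) (count≤size p∨q)))
  where
  p∧q p∨q : Fin M → Bool
  p∧q x = p x ∧ q x
  p∨q x = p x ∨ q x

-- A bipartite graph between two copies of Fin M is an adjacency function;
-- a perfect matching is a permutation σ pairing every i with a neighbour σ i.
PerfectMatching : {M : ℕ} → (Fin M → Fin M → Bool) → Set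
PerfectMatching {M} adj = Σ (Permutation M M) λ σ → ∀ i → T (adj i (σ ⟨$⟩ʳ i))

transpose-cases : {M : ℕ} (i j k : Fin M) →
  (k ≡ i × PC.transpose i j k ≡ j) ⊎ (k ≡ j × PC.transpose i j k ≡ i) ⊎ PC.transpose i j k ≡ k
transpose-cases i j k with k ≟ i
... | yes k≡i = inj₁ (k≡i , refl)
... | no _ with k ≟ j
...   | yes k≡j = inj₂ (inj₁ (k≡j , refl))
...   | no _    = inj₂ (inj₂ refl)

transpose-sends-i : {M : ℕ} (i j : Fin M) → PC.transpose i j i ≡ j
transpose-sends-i i j with i ≟ i
... | yes _   = refl
... | no i≢i = ⊥-elim (i≢i refl)

module DiracMatching {M : ℕ} (adj : Fin M → Fin M → Bool)
  (row-degree : ∀ i → M ≤ 2 * count (adj i))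
  (column-degree : ∀ j → M ≤ 2 * count (λ i → adj i j)) where

  matched : Permutation M M → Fin M → Bool
  matched σ i = adj i (σ ⟨$⟩ʳ i)

  -- for unmatched u, the sets {x | u ~ σ x} and {x | x ~ σ u} have size ≥ M/2
  -- and both miss u, so they share some x
  exchange-partner : (σ : Permutation M M) (u : Fin M) → ¬ T (matched σ u) →
    ∃ λ x → T (adj u (σ ⟨$⟩ʳ x)) × T (adj x (σ ⟨$⟩ʳ u))
  exchange-partner σ u unmatched =
    halves-intersect (λ x → adj u (σ ⟨$⟩ʳ x)) (λ x → adj x (σ ⟨$⟩ʳ u))
      (subst (λ n → M ≤ 2 * n) (sym (count-permute (adj u) σ)) (row-degree u))
      (column-degree (σ ⟨$⟩ʳ u)) u unmatched unmatched

  -- swapping the partners of u and such an x matches u and keeps every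
  -- matched vertex matched, so the number of matched vertices grows
  repair : (σ : Permutation M M) (u : Fin M) → ¬ T (matched σ u) →
    Σ (Permutation M M) λ σ' → count (matched σ) < count (matched σ')
  repair σ u unmatched with exchange-partner σ u unmatched
  ... | x , u~σx , x~σu = σ' , count-strict (matched σ) (matched σ') kept u gained unmatched
    where
    σ' : Permutation M M
    σ' = transpose u x ∘ₚ σ

    via : ∀ {k} z → PC.transpose u x k ≡ z → T (adj k (σ ⟨$⟩ʳ z)) → T (matched σ' k)
    via z eq = subst (λ w → T (adj _ (σ ⟨$⟩ʳ w))) (sym eq)

    gained : T (matched σ' u)
    gained = via x (transpose-sends-i u x) u~σx

    kept : ∀ k → T (matched σ k) → T (matched σ' k)
    kept k k-matched with transpose-cases u x k
    ... | inj₁ (refl , eq)        = via x eq u~σx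
    ... | inj₂ (inj₁ (refl , eq)) = via u eq x~σu
    ... | inj₂ (inj₂ eq)          = via k eq k-matched

  -- repeated repair; `fuel` bounds the number of still unmatched vertices
  grow : (fuel : ℕ) (σ : Permutation M M) → M ≤ fuel + count (matched σ) → PerfectMatching adj
  grow fuel σ bound with all? (λ i → T? (matched σ i))
  ... | yes perfect = σ , perfect
  ... | no imperfect with ¬∀⟶∃¬ M _ (λ i → T? (matched σ i)) imperfect
  ...   | u , unmatched with fuel | repair σ u unmatched
  ...     | zero      | _        = ⊥-elim (<⇒≱ (count<size (matched σ) u unmatched) bound)
  ...     | suc fuel′ | σ′ , more = grow fuel′ σ′ (begin
    M                                   ≤⟨ bound ⟩
    suc fuel′ + count (matched σ)       ≡⟨ +-suc fuel′ _ ⟨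
    fuel′ + suc (count (matched σ))     ≤⟨ +-monoʳ-≤ fuel′ more ⟩
    fuel′ + count (matched σ′)          ∎)
    where open ≤-Reasoning

  perfect-matching : PerfectMatching adj
  perfect-matching = grow M Perm.id (m≤m+n M _)

dense : {M : ℕ} (p : Fin M → Bool) → 3 * M ≤ 4 * countT p → 3 * M ≤ 4 * count p
dense {M} p = subst (λ n → 3 * M ≤ 4 * n) (countT≡count p)

-- given a matching σ of V₁ with V₂, the vertex c ∈ V₃ completes a ∈ V₁ to a
-- triangle a, σ a, c exactly when c is a common neighbour of a and σ a
completes : {M : ℕ} → Tripartite M → Permutation M M → Fin M → Fin M → Bool
completes G σ a c = e₁₃ G a c ∧ e₂₃ G (σ ⟨$⟩ʳ a) c

permutation-injective : {M : ℕ} (π : Permutation M M) {r s : Fin M} → π ⟨$⟩ʳ r ≡ π ⟨$⟩ʳ s → r ≡ s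
permutation-injective π = Injection.injective (↔⇒↣ π)

proposition1 : (M : ℕ) → (G : Tripartite M) → MinDegree G → HasDisjointTriangles G M
proposition1 M G (d₁₂ , d₁₃ , d₂₁ , d₂₃ , d₃₁ , d₃₂) = triangle , is-triangle , disjoint
  where
  half : (p : Fin M → Bool) → 3 * M ≤ 4 * countT p → M ≤ 2 * count p
  half p = three-quarters⇒half M (count p) ∘ dense p

  σ-matching : PerfectMatching (e₁₂ G)
  σ-matching = DiracMatching.perfect-matching (e₁₂ G)
    (λ i → half (e₁₂ G i) (d₁₂ i)) (λ j → half (λ i → e₁₂ G i j) (d₂₁ j))

  σ : Permutation M M
  σ = proj₁ σ-matching

  τ-matching : PerfectMatching (completes G σ)
  τ-matching = DiracMatching.perfect-matching (completes G σ)
    (λ a → three-quarters-meet (e₁₃ G a) (e₂₃ G (σ ⟨$⟩ʳ a))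
      (dense (e₁₃ G a) (d₁₃ a)) (dense (e₂₃ G (σ ⟨$⟩ʳ a)) (d₂₃ (σ ⟨$⟩ʳ a))))
    (λ c → three-quarters-meet (λ a → e₁₃ G a c) (λ a → e₂₃ G (σ ⟨$⟩ʳ a) c)
      (dense (λ a → e₁₃ G a c) (d₃₁ c))
      (subst (λ n → 3 * M ≤ 4 * n) (sym (count-permute (λ b → e₂₃ G b c) σ))
        (dense (λ b → e₂₃ G b c) (d₃₂ c))))

  τ : Permutation M M
  τ = proj₁ τ-matching

  triangle : Fin M → Triple M
  triangle r = r , σ ⟨$⟩ʳ r , τ ⟨$⟩ʳ r

  is-triangle : ∀ r → IsTriangle G (triangle r)
  is-triangle r = proj₂ σ-matching r , Equivalence.to T-∧ (proj₂ τ-matching r)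

  disjoint : ∀ r s → ¬ r ≡ s → Disjoint (triangle r) (triangle s)
  disjoint r s r≢s = r≢s , r≢s ∘ permutation-injective σ , r≢s ∘ permutation-injective τ
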